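{- Let $G$ be a finite group, let $\Gamma={\rm Cay}(G,G\setminus\{1_G\})$ be the complete graph viewed as a Cayley graph on $G$, and let $\varphi$ be a color-preserving automorphism of $\Gamma$ with $\varphi(1_G)=1_G$. If $g,x\in G$ satisfy $\varphi(x)=x^{ -1}\neq x$ and $\varphi(g)=g$, then $x^{ -1}gx=g^{ -1}$. Furthermore, if $\varphi$ does not invert every element of $G$ (i.e. $\varphi(y)\ne y^{ -1}$ for some $y\in G$), then $|x|=4$.
   Context: For a group $G$ and $S\subseteq G$ with $1_G\notin S$ and $S=S^{ -1}$, the Cayley graph ${\rm Cay}(G,S)$ has vertex set $G$ and edges $\{g,gs\}$ for $g\in G$, $s\in S$. Each edge $\{g,gs\}$ is colored by the color $c(s)$, where $c(s)=c(s')$ iff $s'\in\{s,s^{ -1}\}$. An automorphism is color-preserving if it maps each color class of edges onto itself (equivalently it maps each edge $(u,us)$ to an edge $(v,vs)$ or $(v,vs^{ -1})$). -}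

module Defs where

open import Level using (Level; _⊔_)
open import Algebra.Bundles using (Group)
open import Data.Nat using (ℕ; zero; suc; _≤_; _<_)
open import Data.Fin using (Fin)
open import Data.Product using (Σ; ∃; _×_; _,_)
open import Data.Sum using (_⊎_)
open import Relation.Nullary using (¬_)

module _ {c ℓ : Level} (G : Group c ℓ) where
  open Group G

  IsFiniteGroup : Set (c ⊔ ℓ)
  IsFiniteGroup = Σ ℕ λ n → Σ (Fin n → Carrier) λ f → ∀ x → ∃ λ i → f i ≈ x

  pow : Carrier → ℕ → Carrier
  pow x zero    = ε
  pow x (suc n) = x ∙ pow x n

  HasOrder : Carrier → ℕ → Set ℓ
  HasOrder x n = (1 ≤ n) × (pow x n ≈ ε) × (∀ k → 1 ≤ k → k < n → ¬ (pow x k ≈ ε))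

  -- φ is an automorphism (bijection on vertices) of the complete graph
  -- Cay(G, G ∖ {1}); since the graph is complete, any bijection of G is a
  -- graph automorphism.
  IsVertexBijection : (Carrier → Carrier) → Set (c ⊔ ℓ)
  IsVertexBijection φ =
      (∀ {u v} → u ≈ v → φ u ≈ φ v)
    × (∀ {u v} → φ u ≈ φ v → u ≈ v)
    × (∀ v → ∃ λ u → φ u ≈ v)

  -- color-preserving: each edge {u, u s} (s ≠ 1) is mapped to an edge
  -- {φ u, φ u s} or {φ u, φ u s⁻¹}, i.e. an edge of the same color c(s).
  IsColorPreserving : (Carrier → Carrier) → Set (c ⊔ ℓ)
  IsColorPreserving φ =
    ∀ u s → ¬ (s ≈ ε) → (φ (u ∙ s) ≈ φ u ∙ s) ⊎ (φ (u ∙ s) ≈ φ u ∙ s ⁻¹)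

  IsColorPreservingAut : (Carrier → Carrier) → Set (c ⊔ ℓ)
  IsColorPreservingAut φ = IsVertexBijection φ × IsColorPreserving φ

module Submission where

-- Taking u = 1 shows that every element is
-- either fixed or inverted by φ.  Taking u = g fixed and s = g⁻¹ a with a
-- inverted gives the key dichotomy: either a is an involution, or
-- a⁻¹ = g (g⁻¹ a)⁻¹, which rearranges to a⁻¹ g a = g⁻¹.  This is the first
-- claim.  For the second, φ also inverts x², and conjugation by x² fixes
-- every fixed element y (it inverts y twice); applying the dichotomy to x²
-- and a fixed non-inverted y (which is not an involution) forces x² to be
-- an involution, so x⁴ = 1 while x, x² ≠ 1 because x is not an involution.

open import Defs
open import Level using (Level)
open import Algebra.Bundles using (Group)
open import Data.Product using (∃; _×_; _,_; proj₁; proj₂)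
open import Relation.Nullary using (¬_)
open import Data.Sum using (_⊎_; inj₁; inj₂)
open import Data.Nat using (suc; _≤_; _<_; z≤n; s≤s)
open import Data.Empty using (⊥-elim)
import Algebra.Properties.Group as GroupProperties
import Relation.Binary.Reasoning.Setoid as SetoidReasoning

module GroupFacts {c ℓ : Level} (G : Group c ℓ) where
  open Group G
  open GroupProperties G
  open SetoidReasoning setoid

  conj : Carrier → Carrier → Carrier
  conj a b = a ⁻¹ ∙ b ∙ a

  conj-cong : ∀ a {b b′} → b ≈ b′ → conj a b ≈ conj a b′
  conj-cong a b≈b′ = ∙-congʳ (∙-congˡ b≈b′)

  conj-⁻¹ : ∀ a b → conj a (b ⁻¹) ≈ conj a b ⁻¹
  conj-⁻¹ a b = sym (begin
    (a ⁻¹ ∙ b ∙ a) ⁻¹        ≈⟨ ⁻¹-anti-homo-∙ _ a ⟩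
    a ⁻¹ ∙ (a ⁻¹ ∙ b) ⁻¹     ≈⟨ ∙-congˡ (⁻¹-anti-homo-∙ (a ⁻¹) b) ⟩
    a ⁻¹ ∙ (b ⁻¹ ∙ a ⁻¹ ⁻¹)  ≈⟨ ∙-congˡ (∙-congˡ (⁻¹-involutive a)) ⟩
    a ⁻¹ ∙ (b ⁻¹ ∙ a)        ≈⟨ assoc (a ⁻¹) (b ⁻¹) a ⟨
    a ⁻¹ ∙ b ⁻¹ ∙ a          ∎)

  conj-square : ∀ a b → conj (a ∙ a) b ≈ conj a (conj a b)
  conj-square a b = begin
    (a ∙ a) ⁻¹ ∙ b ∙ (a ∙ a)       ≈⟨ ∙-congʳ (∙-congʳ (⁻¹-anti-homo-∙ a a)) ⟩
    a ⁻¹ ∙ a ⁻¹ ∙ b ∙ (a ∙ a)      ≈⟨ assoc _ a a ⟨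
    a ⁻¹ ∙ a ⁻¹ ∙ b ∙ a ∙ a        ≈⟨ ∙-congʳ (∙-congʳ (assoc (a ⁻¹) (a ⁻¹) b)) ⟩
    a ⁻¹ ∙ (a ⁻¹ ∙ b) ∙ a ∙ a      ≈⟨ ∙-congʳ (assoc (a ⁻¹) (a ⁻¹ ∙ b) a) ⟩
    a ⁻¹ ∙ (a ⁻¹ ∙ b ∙ a) ∙ a      ∎

  inverting-square-centralises : ∀ a b → conj a b ≈ b ⁻¹ → conj (a ∙ a) b ≈ b
  inverting-square-centralises a b ab≈b⁻¹ = begin
    conj (a ∙ a) b     ≈⟨ conj-square a b ⟩
    conj a (conj a b)  ≈⟨ conj-cong a ab≈b⁻¹ ⟩
    conj a (b ⁻¹)      ≈⟨ conj-⁻¹ a b ⟩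
    conj a b ⁻¹        ≈⟨ ⁻¹-cong ab≈b⁻¹ ⟩
    b ⁻¹ ⁻¹            ≈⟨ ⁻¹-involutive b ⟩
    b                  ∎

  -- The relation a⁻¹ = g (g⁻¹ a)⁻¹ produced by colour preservation says
  -- exactly that a inverts g by conjugation.
  twisted-relation⇒conj-inverts : ∀ a g → a ⁻¹ ≈ g ∙ (g \\ a) ⁻¹ → conj a g ≈ g ⁻¹
  twisted-relation⇒conj-inverts a g rel = begin
    a ⁻¹ ∙ g ∙ a    ≈⟨ ∙-congʳ g⁻¹a⁻¹≈a⁻¹g ⟨
    g ⁻¹ ∙ a ⁻¹ ∙ a ≈⟨ //-rightDividesˡ a (g ⁻¹) ⟩
    g ⁻¹            ∎
    where
    a⁻¹≈ga⁻¹g : a ⁻¹ ≈ g ∙ (a ⁻¹ ∙ g)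
    a⁻¹≈ga⁻¹g = trans rel (∙-congˡ (⁻¹-anti-homo-\\ g a))

    g⁻¹a⁻¹≈a⁻¹g : g ⁻¹ ∙ a ⁻¹ ≈ a ⁻¹ ∙ g
    g⁻¹a⁻¹≈a⁻¹g = trans (∙-congˡ a⁻¹≈ga⁻¹g) (\\-leftDividesʳ g (a ⁻¹ ∙ g))

  -- g⁻¹ a = 1 only when g = a; needed to see that {g, a} is an edge.
  \\≈ε⇒≈ : ∀ g a → g \\ a ≈ ε → g ≈ a
  \\≈ε⇒≈ g a g\\a≈ε = ⁻¹-injective (inverseˡ-unique (g ⁻¹) a g\\a≈ε)

  non-involution⇒≉ε : ∀ {x} → ¬ (x ⁻¹ ≈ x) → ¬ (x ≈ ε)
  non-involution⇒≉ε {x} x⁻¹≉x x≈ε = x⁻¹≉x (begin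
    x ⁻¹  ≈⟨ ⁻¹-cong x≈ε ⟩
    ε ⁻¹  ≈⟨ ε⁻¹≈ε ⟩
    ε     ≈⟨ x≈ε ⟨
    x     ∎)

  non-involution⇒square≉ε : ∀ {x} → ¬ (x ⁻¹ ≈ x) → ¬ (x ∙ x ≈ ε)
  non-involution⇒square≉ε {x} x⁻¹≉x xx≈ε = x⁻¹≉x (sym (inverseˡ-unique x x xx≈ε))

  order-four : ∀ {x} → ¬ (x ≈ ε) → ¬ (x ∙ x ≈ ε) → (x ∙ x) ⁻¹ ≈ x ∙ x →
               HasOrder G x 4
  order-four {x} x≉ε xx≉ε xx-self-inverse = s≤s z≤n , x⁴≈ε , smaller-powers≉ε
    where
    x⁴≈ε : pow G x 4 ≈ ε
    x⁴≈ε = begin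
      x ∙ (x ∙ (x ∙ (x ∙ ε)))  ≈⟨ ∙-congˡ (∙-congˡ (∙-congˡ (identityʳ x))) ⟩
      x ∙ (x ∙ (x ∙ x))        ≈⟨ assoc x x (x ∙ x) ⟨
      x ∙ x ∙ (x ∙ x)          ≈⟨ ∙-congˡ xx-self-inverse ⟨
      x ∙ x ∙ (x ∙ x) ⁻¹       ≈⟨ inverseʳ (x ∙ x) ⟩
      ε                        ∎

    smaller-powers≉ε : ∀ k → 1 ≤ k → k < 4 → ¬ (pow G x k ≈ ε)
    smaller-powers≉ε 0 () _
    smaller-powers≉ε 1 _ _ x¹≈ε = x≉ε (trans (sym (identityʳ x)) x¹≈ε)
    smaller-powers≉ε 2 _ _ x²≈ε = xx≉ε (trans (∙-congˡ (sym (identityʳ x))) x²≈ε)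
    smaller-powers≉ε 3 _ _ x³≈ε = x≉ε (begin
      x                        ≈⟨ identityʳ x ⟨
      x ∙ ε                    ≈⟨ ∙-congˡ x³≈ε ⟨
      x ∙ (x ∙ (x ∙ (x ∙ ε)))  ≈⟨ x⁴≈ε ⟩
      ε                        ∎)
    smaller-powers≉ε (suc (suc (suc (suc _)))) _ (s≤s (s≤s (s≤s (s≤s ()))))

module ColourPreserving {c ℓ : Level} (G : Group c ℓ)
  (φ : Group.Carrier G → Group.Carrier G) (aut : IsColorPreservingAut G φ)
  (φε≈ε : Group._≈_ G (φ (Group.ε G)) (Group.ε G)) where
  open Group G
  open GroupProperties G
  open GroupFacts G
  open SetoidReasoning setoid

  φ-cong : ∀ {u v} → u ≈ v → φ u ≈ φ v
  φ-cong = proj₁ (proj₁ aut)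

  φ-injective : ∀ {u v} → φ u ≈ φ v → u ≈ v
  φ-injective = proj₁ (proj₂ (proj₁ aut))

  colour : IsColorPreserving G φ
  colour = proj₂ aut

  -- Colour preservation at the edge {1, y}: φ(y) is y or y⁻¹.
  not-inverted⇒fixed : ∀ {y} → ¬ (φ y ≈ y ⁻¹) → φ y ≈ y
  not-inverted⇒fixed {y} φy≉y⁻¹ with colour ε y y≉ε
    where
    y≉ε : ¬ (y ≈ ε)
    y≉ε y≈ε = φy≉y⁻¹ (begin
      φ y   ≈⟨ φ-cong y≈ε ⟩
      φ ε   ≈⟨ φε≈ε ⟩
      ε     ≈⟨ ε⁻¹≈ε ⟨
      ε ⁻¹  ≈⟨ ⁻¹-cong y≈ε ⟨
      y ⁻¹  ∎)
  ... | inj₁ φy≈φεy  = trans (φ-cong (sym (identityˡ y)))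
                         (trans φy≈φεy (trans (∙-congʳ φε≈ε) (identityˡ y)))
  ... | inj₂ φy≈φεy⁻¹ = ⊥-elim (φy≉y⁻¹
                         (trans (φ-cong (sym (identityˡ y)))
                           (trans φy≈φεy⁻¹ (trans (∙-congʳ φε≈ε) (identityˡ (y ⁻¹))))))

  fixed≈inverted⇒involution : ∀ {a g} → φ a ≈ a ⁻¹ → φ g ≈ g → g ≈ a → a ⁻¹ ≈ a
  fixed≈inverted⇒involution {a} {g} φa≈a⁻¹ φg≈g g≈a = begin
    a ⁻¹  ≈⟨ φa≈a⁻¹ ⟨
    φ a   ≈⟨ φ-cong g≈a ⟨
    φ g   ≈⟨ φg≈g ⟩
    g     ≈⟨ g≈a ⟩
    a     ∎

  -- Colour preservation at the edge {x, x·x}: φ(x²) is φ(x)x = 1 = φ(1),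
  -- impossible by injectivity, or φ(x)x⁻¹ = x⁻².
  square-inverted : ∀ {x} → φ x ≈ x ⁻¹ → ¬ (x ⁻¹ ≈ x) → φ (x ∙ x) ≈ (x ∙ x) ⁻¹
  square-inverted {x} φx≈x⁻¹ x⁻¹≉x with colour x x (non-involution⇒≉ε x⁻¹≉x)
  ... | inj₁ φxx≈φx∙x = ⊥-elim (non-involution⇒square≉ε x⁻¹≉x
          (φ-injective (begin
            φ (x ∙ x)   ≈⟨ φxx≈φx∙x ⟩
            φ x ∙ x     ≈⟨ ∙-congʳ φx≈x⁻¹ ⟩
            x ⁻¹ ∙ x    ≈⟨ inverseˡ x ⟩
            ε           ≈⟨ φε≈ε ⟨
            φ ε         ∎)))
  ... | inj₂ φxx≈φx∙x⁻¹ = begin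
            φ (x ∙ x)    ≈⟨ φxx≈φx∙x⁻¹ ⟩
            φ x ∙ x ⁻¹   ≈⟨ ∙-congʳ φx≈x⁻¹ ⟩
            x ⁻¹ ∙ x ⁻¹  ≈⟨ ⁻¹-anti-homo-∙ x x ⟨
            (x ∙ x) ⁻¹   ∎

  -- Colour preservation at the edge {g, a} for a fixed g and an inverted a:
  -- either a is an involution or a inverts g by conjugation.
  fixed-inverted-dichotomy : ∀ {a g} → φ a ≈ a ⁻¹ → φ g ≈ g → ¬ (g ≈ a) →
                             (a ⁻¹ ≈ a) ⊎ (conj a g ≈ g ⁻¹)
  fixed-inverted-dichotomy {a} {g} φa≈a⁻¹ φg≈g g≉a
    with colour g (g \\ a) (λ g\\a≈ε → g≉a (\\≈ε⇒≈ g a g\\a≈ε))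
  ... | inj₁ edge = inj₁ (begin
          a ⁻¹                ≈⟨ φa≈a⁻¹ ⟨
          φ a                 ≈⟨ φ-cong (\\-leftDividesˡ g a) ⟨
          φ (g ∙ (g \\ a))    ≈⟨ edge ⟩
          φ g ∙ (g \\ a)      ≈⟨ ∙-congʳ φg≈g ⟩
          g ∙ (g \\ a)        ≈⟨ \\-leftDividesˡ g a ⟩
          a                   ∎)
  ... | inj₂ edge = inj₂ (twisted-relation⇒conj-inverts a g (begin
          a ⁻¹                ≈⟨ φa≈a⁻¹ ⟨
          φ a                 ≈⟨ φ-cong (\\-leftDividesˡ g a) ⟨
          φ (g ∙ (g \\ a))    ≈⟨ edge ⟩
          φ g ∙ (g \\ a) ⁻¹   ≈⟨ ∙-congʳ φg≈g ⟩
          g ∙ (g \\ a) ⁻¹     ∎))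

  inverted-conjugates-fixed : ∀ {g x} → φ x ≈ x ⁻¹ → ¬ (x ⁻¹ ≈ x) → φ g ≈ g →
                              conj x g ≈ g ⁻¹
  inverted-conjugates-fixed φx≈x⁻¹ x⁻¹≉x φg≈g
    with fixed-inverted-dichotomy φx≈x⁻¹ φg≈g
           (λ g≈x → x⁻¹≉x (fixed≈inverted⇒involution φx≈x⁻¹ φg≈g g≈x))
  ... | inj₁ x⁻¹≈x    = ⊥-elim (x⁻¹≉x x⁻¹≈x)
  ... | inj₂ xg≈g⁻¹  = xg≈g⁻¹

  square-self-inverse : ∀ {x y} → φ x ≈ x ⁻¹ → ¬ (x ⁻¹ ≈ x) → ¬ (φ y ≈ y ⁻¹) →
                        (x ∙ x) ⁻¹ ≈ x ∙ x
  square-self-inverse {x} {y} φx≈x⁻¹ x⁻¹≉x φy≉y⁻¹ =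
    conclude (fixed-inverted-dichotomy (square-inverted φx≈x⁻¹ x⁻¹≉x) φy≈y y≉xx)
    where
    φy≈y : φ y ≈ y
    φy≈y = not-inverted⇒fixed φy≉y⁻¹

    y≉xx : ¬ (y ≈ x ∙ x)
    y≉xx y≈xx = φy≉y⁻¹ (begin
      φ y          ≈⟨ φ-cong y≈xx ⟩
      φ (x ∙ x)    ≈⟨ square-inverted φx≈x⁻¹ x⁻¹≉x ⟩
      (x ∙ x) ⁻¹   ≈⟨ ⁻¹-cong y≈xx ⟨
      y ⁻¹         ∎)

    -- x² centralises y (x inverts y), so x² cannot also invert y.
    conclude : ((x ∙ x) ⁻¹ ≈ x ∙ x) ⊎ (conj (x ∙ x) y ≈ y ⁻¹) → (x ∙ x) ⁻¹ ≈ x ∙ x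
    conclude (inj₁ xx-self-inverse) = xx-self-inverse
    conclude (inj₂ xxy≈y⁻¹) = ⊥-elim (φy≉y⁻¹ (begin
      φ y             ≈⟨ φy≈y ⟩
      y               ≈⟨ inverting-square-centralises x y
                           (inverted-conjugates-fixed φx≈x⁻¹ x⁻¹≉x φy≈y) ⟨
      conj (x ∙ x) y  ≈⟨ xxy≈y⁻¹ ⟩
      y ⁻¹            ∎))

lemma2p1 : {c ℓ : Level} (G : Group c ℓ) → IsFiniteGroup G →
    (φ : Group.Carrier G → Group.Carrier G) → IsColorPreservingAut G φ →
    Group._≈_ G (φ (Group.ε G)) (Group.ε G) →
    (g x : Group.Carrier G) →
    Group._≈_ G (φ x) (Group._⁻¹ G x) → ¬ (Group._≈_ G (Group._⁻¹ G x) x) →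
    Group._≈_ G (φ g) g →
    Group._≈_ G (Group._∙_ G (Group._∙_ G (Group._⁻¹ G x) g) x) (Group._⁻¹ G g)
    × ((∃ λ y → ¬ (Group._≈_ G (φ y) (Group._⁻¹ G y))) → HasOrder G x 4)
lemma2p1 G _ φ aut φε≈ε g x φx≈x⁻¹ x⁻¹≉x φg≈g =
    inverted-conjugates-fixed φx≈x⁻¹ x⁻¹≉x φg≈g
  , λ { (y , φy≉y⁻¹) →
        order-four (non-involution⇒≉ε x⁻¹≉x) (non-involution⇒square≉ε x⁻¹≉x)
                   (square-self-inverse φx≈x⁻¹ x⁻¹≉x φy≉y⁻¹) }
  where
  open GroupFacts G
  open ColourPreserving G φ aut φε≈ε
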